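{- Let $S$ be a commutative semigroup and $s\in S$ with ${\rm St}(H_s)\ne\emptyset$. Let $V=\{x\in S:x\preceq_{\mathcal H}s\}$. Then the group $\Gamma(H_s)$ acts on the set $V$ via $\gamma_a\circ x=a+x$ for $a\in{\rm St}(H_s)$ and $x\in V$.
   Context: $S$ is written additively; $(a)=\{a\}\cup\{a+c:c\in S\}$; $x\preceq_{\mathcal H}s$ iff $(x)\subseteq(s)$, i.e. $x=s$ or $x=s+c$ for some $c\in S$; $a\,\mathcal H\,b$ iff $(a)=(b)$; $H_s$ is the class of $s$. ${\rm St}(H_s)=\{c\in S:c+x\in H_s\ \forall x\in H_s\}$; for $c\in{\rm St}(H_s)$, $\gamma_c:H_s\to H_s$, $x\mapsto c+x$; $\Gamma(H_s)=\{\gamma_c:c\in{\rm St}(H_s)\}$ with operation $\gamma_c+\gamma_d=\gamma_{c+d}$ is an abelian group. -}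

module Defs where

open import Level using (Level; _⊔_)
open import Algebra.Bundles using (CommutativeSemigroup)
open import Data.Product using (Σ; ∃; _×_; _,_)
open import Data.Sum using (_⊎_)

module HDefs {c ℓ : Level} (S : CommutativeSemigroup c ℓ) where
  open CommutativeSemigroup S renaming (Carrier to A; _∙_ to _+_)

  -- membership in the principal ideal (a) = {a} ∪ {a + c : c ∈ S}
  _∈⟨_⟩ : A → A → Set (c ⊔ ℓ)
  y ∈⟨ a ⟩ = (y ≈ a) ⊎ Σ A (λ d → y ≈ a + d)

  _⪯H_ : A → A → Set (c ⊔ ℓ)
  x ⪯H s = ∀ y → y ∈⟨ x ⟩ → y ∈⟨ s ⟩

  _H_ : A → A → Set (c ⊔ ℓ)
  a H b = (a ⪯H b) × (b ⪯H a)

  InH : A → A → Set (c ⊔ ℓ)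
  InH s x = x H s

  InSt : A → A → Set (c ⊔ ℓ)
  InSt s d = ∀ x → InH s x → InH s (d + x)

  InV : A → A → Set (c ⊔ ℓ)
  InV s x = x ⪯H s

  -- Γ(H_s) = {γ_a : a ∈ St(H_s)}, where γ_a = γ_b iff they agree on H_s;
  -- identity of Γ(H_s) is the identity map of H_s; γ_a + γ_b = γ_{a+b}.
  -- "Γ(H_s) acts on V via γ_a ∘ x = a + x":
  record ActsOnV (s : A) : Set (c ⊔ ℓ) where
    field
      closed : ∀ a → InSt s a → ∀ x → InV s x → InV s (a + x)
      -- well defined: depends only on γ_a, not on the representative a
      well-defined : ∀ a b → InSt s a → InSt s b →
                     (∀ y → InH s y → (a + y) ≈ (b + y)) →
                     ∀ x → InV s x → (a + x) ≈ (b + x)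
      identity : ∀ e → InSt s e → (∀ y → InH s y → (e + y) ≈ y) →
                 ∀ x → InV s x → (e + x) ≈ x
      compatible : ∀ a b → InSt s a → InSt s b →
                   ∀ x → InV s x → ((a + b) + x) ≈ (a + (b + x))

{-# OPTIONS --safe #-}
module Submission where

open import Defs
open import Level using (Level)
open import Algebra.Bundles using (CommutativeSemigroup)
open import Data.Product using (Σ; _,_)
open import Data.Sum using (inj₁; inj₂)
open import Function using (id)

-- Every element of V lies in the principal ideal (s), i.e. is s or s + d. A map
-- commuting with right translations is therefore determined on (s) by its value
-- at s; both γ_a ↦ a + x and the identity are such maps, which gives
-- well-definedness and the identity law. Closure holds because a + x ⪯_H x.

module PrincipalIdeals {c ℓ : Level} (S : CommutativeSemigroup c ℓ) where
  open CommutativeSemigroup S renaming (Carrier to A; _∙_ to _+_)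
  open HDefs S
  open import Relation.Binary.Reasoning.Setoid setoid

  ⪯H-refl : ∀ {x} → x ⪯H x
  ⪯H-refl y y∈⟨x⟩ = y∈⟨x⟩

  ⪯H-trans : ∀ {x y z} → x ⪯H y → y ⪯H z → x ⪯H z
  ⪯H-trans x⪯y y⪯z w w∈⟨x⟩ = y⪯z w (x⪯y w w∈⟨x⟩)

  H-refl : ∀ {x} → x H x
  H-refl = ⪯H-refl , ⪯H-refl

  ⪯H⇒∈⟨⟩ : ∀ {x s} → x ⪯H s → x ∈⟨ s ⟩
  ⪯H⇒∈⟨⟩ x⪯s = x⪯s _ (inj₁ refl)

  +-⪯H : ∀ a x → (a + x) ⪯H x
  +-⪯H a x y (inj₁ y≈a+x)       = inj₂ (a , trans y≈a+x (comm a x))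
  +-⪯H a x y (inj₂ (d , y≈a+x+d)) = inj₂ (a + d , (begin
    y             ≈⟨ y≈a+x+d ⟩
    (a + x) + d   ≈⟨ ∙-congʳ (comm a x) ⟩
    (x + a) + d   ≈⟨ assoc x a d ⟩
    x + (a + d)   ∎))

  module _ {f g : A → A}
           (f-cong : ∀ {x y} → x ≈ y → f x ≈ f y) (f-+ : ∀ x d → f (x + d) ≈ f x + d)
           (g-cong : ∀ {x y} → x ≈ y → g x ≈ g y) (g-+ : ∀ x d → g (x + d) ≈ g x + d)
           where

    translation-equivariant-agree : ∀ {s x} → f s ≈ g s → x ∈⟨ s ⟩ → f x ≈ g x
    translation-equivariant-agree {s} {x} fs≈gs (inj₁ x≈s) = begin
      f x   ≈⟨ f-cong x≈s ⟩
      f s   ≈⟨ fs≈gs ⟩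
      g s   ≈⟨ g-cong (sym x≈s) ⟩
      g x   ∎
    translation-equivariant-agree {s} {x} fs≈gs (inj₂ (d , x≈s+d)) = begin
      f x         ≈⟨ f-cong x≈s+d ⟩
      f (s + d)   ≈⟨ f-+ s d ⟩
      f s + d     ≈⟨ ∙-congʳ fs≈gs ⟩
      g s + d     ≈⟨ g-+ s d ⟨
      g (s + d)   ≈⟨ g-cong (sym x≈s+d) ⟩
      g x         ∎

  +ˡ-translation-equivariant : ∀ a x d → a + (x + d) ≈ (a + x) + d
  +ˡ-translation-equivariant a x d = sym (assoc a x d)

module Action {c ℓ : Level} (S : CommutativeSemigroup c ℓ) (s : CommutativeSemigroup.Carrier S) where
  open CommutativeSemigroup S renaming (Carrier to A; _∙_ to _+_)
  open HDefs S
  open PrincipalIdeals S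

  closed : ∀ a x → InV s x → InV s (a + x)
  closed a x x⪯s = ⪯H-trans (+-⪯H a x) x⪯s

  well-defined : ∀ a b → (∀ y → InH s y → a + y ≈ b + y) → ∀ x → InV s x → a + x ≈ b + x
  well-defined a b γa≗γb x x⪯s =
    translation-equivariant-agree ∙-congˡ (+ˡ-translation-equivariant a)
                                  ∙-congˡ (+ˡ-translation-equivariant b)
                                  (γa≗γb s H-refl) (⪯H⇒∈⟨⟩ x⪯s)

  identity : ∀ e → (∀ y → InH s y → e + y ≈ y) → ∀ x → InV s x → e + x ≈ x
  identity e γe≗id x x⪯s =
    translation-equivariant-agree ∙-congˡ (+ˡ-translation-equivariant e)
                                  id (λ _ _ → refl)
                                  (γe≗id s H-refl) (⪯H⇒∈⟨⟩ x⪯s)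

lemma3p15 : {c ℓ : Level} (S : CommutativeSemigroup c ℓ) (s : CommutativeSemigroup.Carrier S) →
    Σ (CommutativeSemigroup.Carrier S) (λ a → HDefs.InSt S s a) →
    HDefs.ActsOnV S s
lemma3p15 S s _ = record
  { closed       = λ a _ → closed a
  ; well-defined = λ a b _ _ → well-defined a b
  ; identity     = λ e _ → identity e
  ; compatible   = λ a b _ _ x _ → assoc a b x
  }
  where open CommutativeSemigroup S using (assoc)
        open Action S s
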